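{- Let $k\ge 2$ and $\pi\in S_k$. Let $\pi'\in S_{k-1}$ be the permutation obtained by removing the entry $1$ from $\pi$ (viewed as the sequence $\pi(1),\dots,\pi(k)$) and then normalizing the result. Then for every integer $n>1$, $$g(\pi,n) \le 30(\log_2 n)\cdot g(\pi',n).$$
   Context: For $\sigma\in S_m$, a $\sigma$-wave is an increasing sequence of integers $x_1<\cdots<x_{m+1}$ such that for all $1\le i,j\le m$, $x_{i+1}-x_i > x_{j+1}-x_j$ if and only if $\sigma(i)>\sigma(j)$. A set of integers is $\sigma$-wave-free if it contains no $\sigma$-wave, and $g(\sigma,n)$ is the largest cardinality of a $\sigma$-wave-free subset of $[n]=\{1,\dots,n\}$. The normalization of a sequence of distinct integers $y_1,\dots,y_m$ is the unique permutation $\tau\in S_m$ with $\tau(i)>\tau(j)$ iff $y_i>y_j$. -}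

module Defs where

open import Data.Nat using (ℕ; suc; _<_; _∸_)
open import Data.Fin using (Fin; toℕ; inject₁; punchIn) renaming (suc to fsuc; zero to fzero)
open import Data.Fin.Permutation using (Permutation′; _⟨$⟩ʳ_; _⟨$⟩ˡ_)
open import Data.Fin.Subset using (Subset; _∈_; ∣_∣)
open import Data.Product using (Σ; _×_)
open import Function.Bundles using (_⇔_)
open import Relation.Nullary using (¬_)

-- Conventions:
--  * S_m is Permutation′ m ; the value j : Fin m stands for the integer toℕ j + 1.
--    Comparisons of permutation values are done via toℕ.
--  * A subset of [n] = {1..n} is a Subset n ; index t : Fin n stands for toℕ t + 1.
--    (The shift by 1 changes neither order nor differences.)

gap : ∀ {m n} → (Fin (suc m) → Fin n) → Fin m → ℕ
gap x i = toℕ (x (fsuc i)) ∸ toℕ (x (inject₁ i))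

IsWave : ∀ {m n} → Permutation′ m → (Fin (suc m) → Fin n) → Set
IsWave {m} σ x =
  ((i : Fin m) → toℕ (x (inject₁ i)) < toℕ (x (fsuc i))) ×
  ((i j : Fin m) → (gap x j < gap x i) ⇔ (toℕ (σ ⟨$⟩ʳ j) < toℕ (σ ⟨$⟩ʳ i)))

WaveFree : ∀ {m n} → Permutation′ m → Subset n → Set
WaveFree {m} {n} σ A =
  ¬ (Σ (Fin (suc m) → Fin n) λ x → IsWave σ x × ((i : Fin (suc m)) → x i ∈ A))

IsG : ∀ {m} → Permutation′ m → (n k : ℕ) → Set
IsG σ n k =
  (Σ (Subset n) λ A → WaveFree σ A × ∣ A ∣ ≡′ k) ×
  ((A : Subset n) → WaveFree σ A → ∣ A ∣ Data.Nat.≤ k)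
  where open import Relation.Binary.PropositionalEquality renaming (_≡_ to _≡′_)

IsNormalization : ∀ {m r} → Permutation′ m → (Fin m → Fin r) → Set
IsNormalization {m} τ y =
  (i j : Fin m) → (toℕ (τ ⟨$⟩ʳ j) < toℕ (τ ⟨$⟩ʳ i)) ⇔ (toℕ (y j) < toℕ (y i))

-- the sequence π(1..k) with the entry 1 (i.e. Fin value zero) removed
removeOne : ∀ {m} → Permutation′ (suc m) → Fin m → Fin (suc m)
removeOne π i = π ⟨$⟩ʳ punchIn (π ⟨$⟩ˡ fzero) i

-- Let A ⊆ [n] be π-wave-free with elements a₁ < ⋯ < a_k. Give each consecutive pair (u, v) = (aₜ, aₜ₊₁)
-- the scale j = ⌊log₂ (v − u)⌋ and, with s = 2^j, the block B = ⌊u / 8s⌋ and the class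
-- c = ⌊(u mod 8s) / s⌋ < 8, so that u = cs + e + 8sB with e < s and s ≤ v − u < 2s. There are at most
-- 8(⌊log₂ n⌋ + 1) colours (j, c). Within one colour the blocks are distinct, since consecutive pairs do not
-- overlap, and the set of blocks is π′-wave-free: given a π′-wave x of blocks with pairs (uᵢ, vᵢ), insert
-- v_p after u_p where π(p) = 1. All these points lie in the windows [cs, cs + 3s) of the blocks x with x_p
-- doubled, so each gap is 8s times the corresponding gap of that block sequence up to an error below 3s.
-- As 2 · 3s ≤ 8s, strict comparisons survive and the new gap v_p − u_p < 2s is the least one: a π-wave
-- inside A. Hence |A| ≤ 1 + 8(⌊log₂ n⌋ + 1) g(π′, n), and
-- 2^|A| ≤ 2 (2^(⌊log₂ n⌋ + 1))^(8 g(π′, n)) ≤ n^(16 g(π′, n) + 1) ≤ n^(30 g(π′, n)).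

module Submission where

open import Defs
open import Data.Nat
  using (ℕ; zero; suc; _+_; _*_; _∸_; _^_; _≤_; _<_; z≤n; s≤s; NonZero; _/_; _%_; _<?_; _≟_; ⌊_/2⌋; ⌈_/2⌉)
open import Data.Nat.Properties
open import Algebra.Properties.CommutativeSemigroup +-commutativeSemigroup using (xy∙z≈xz∙y; interchange)
open import Data.Nat.DivMod using (m≡m%n+[m/n]*n; m%n<n; m<n*o⇒m/o<n; m/n≤m)
open import Data.Nat.Logarithm using (⌊log₂_⌋; ⌊log₂⌋-mono-≤; ⌊log₂⌊n/2⌋⌋≡⌊log₂n⌋∸1; ⌊log₂[2^n]⌋≡n)
open import Data.Fin using (Fin; toℕ; fromℕ<; inject₁; punchIn; punchOut; pinch)
  renaming (zero to fzero; suc to fsuc; _<_ to _<ᶠ_; _≤_ to _≤ᶠ_; _≟_ to _≟ᶠ_)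
open import Data.Fin.Properties using (toℕ<n; toℕ-fromℕ<; toℕ-injective; toℕ-inject₁; punchIn-punchOut)
  renaming (<-irrefl to <ᶠ-irrefl)
open import Data.Fin.Permutation using (Permutation′; _⟨$⟩ʳ_; _⟨$⟩ˡ_; inverseˡ; inverseʳ)
open import Data.Fin.Subset using (Subset; _∈_; ∣_∣; ⁅_⁆; _∪_; inside; outside) renaming (⊥ to ∅)
open import Data.Fin.Subset.Properties
  using (x∈p⇒∣p-x∣<∣p∣; x∈p∧x≢y⇒x∈p-y; x∈p∪q⁻; x∈p∪q⁺; x∈⁅x⁆; x∈⁅y⁆⇒x≡y; ∉⊥; ∣⁅x⁆∣≡1)
open import Data.Vec using ([]; _∷_; here; there)
open import Data.List using (List; []; _∷_; length; map; filter)
open import Data.List.Properties using (length-map; filter-all; filter-none; filter-accept; filter-reject)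
open import Data.List.Membership.Propositional using () renaming (_∈_ to _∈ₗ_)
open import Data.List.Membership.Propositional.Properties using (∈-map⁻)
open import Data.List.Relation.Unary.All as All using (All; []; _∷_)
open import Data.List.Relation.Unary.All.Properties using (map⁺; all-filter) renaming (filter⁺ to All-filter⁺)
open import Data.List.Relation.Unary.Any using (here; there)
open import Data.List.Relation.Unary.AllPairs as AllPairs using (AllPairs; []; _∷_)
import Data.List.Relation.Unary.AllPairs.Properties as AllPairs
open import Data.List.Relation.Unary.Unique.Propositional using (Unique)
open import Data.Product using (∃-syntax; _×_; _,_; proj₁; proj₂)
open import Data.Sum using (inj₁; inj₂)
open import Function.Base using (_∘_)
open import Function.Bundles using (_⇔_; mk⇔; Equivalence)
open import Relation.Nullary using (yes; no; contradiction)
open import Relation.Unary using (Decidable)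
open import Relation.Binary.Definitions using (tri<; tri≈; tri>)
open import Relation.Binary.PropositionalEquality

InWindow : (S o w Y X : ℕ) → Set
InWindow S o w Y X = ∃[ e ] e < w × Y ≡ o + e + X * S

Near : (w D N : ℕ) → Set
Near w D N = D < N + w × N < D + w

window-< : ∀ {S o w Y Y′ X X′} → w ≤ S →
           InWindow S o w Y X → InWindow S o w Y′ X′ → X < X′ → Y < Y′
window-< {S} {o} {w} {X = X} {X′} w≤S (e , e<w , refl) (e′ , _ , refl) X<X′ = begin-strict
  o + e + X * S   <⟨ +-monoˡ-< (X * S) (+-monoʳ-< o e<w) ⟩
  o + w + X * S   ≤⟨ +-monoˡ-≤ (X * S) (+-monoʳ-≤ o w≤S) ⟩
  o + S + X * S   ≡⟨ +-assoc o S (X * S) ⟩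
  o + suc X * S   ≤⟨ +-monoʳ-≤ o (*-monoˡ-≤ S X<X′) ⟩
  o + X′ * S      ≤⟨ +-monoˡ-≤ (X′ * S) (m≤m+n o e′) ⟩
  o + e′ + X′ * S ∎
  where open ≤-Reasoning

window-difference : ∀ {S o w Y X D G} →
                    InWindow S o w Y X → InWindow S o w (Y + D) (X + G) → Near w D (G * S)
window-difference {S} {o} {w} {X = X} {D} {G} (e , e<w , refl) (e′ , e′<w , Y+D≡) =
  D<GS+w , GS<D+w
  where
  balance : e + D ≡ e′ + G * S
  balance = +-cancelˡ-≡ (o + X * S) (e + D) (e′ + G * S) (begin
    o + X * S + (e + D)        ≡⟨ +-assoc (o + X * S) e D ⟨
    o + X * S + e + D          ≡⟨ cong (_+ D) (xy∙z≈xz∙y o (X * S) e) ⟩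
    o + e + X * S + D          ≡⟨ Y+D≡ ⟩
    o + e′ + (X + G) * S       ≡⟨ cong (o + e′ +_) (*-distribʳ-+ S X G) ⟩
    o + e′ + (X * S + G * S)   ≡⟨ interchange o e′ (X * S) (G * S) ⟩
    o + X * S + (e′ + G * S)   ∎)
    where open ≡-Reasoning
  D<GS+w : D < G * S + w
  D<GS+w = begin-strict
    D          ≤⟨ m≤n+m D e ⟩
    e + D      ≡⟨ balance ⟩
    e′ + G * S <⟨ +-monoˡ-< (G * S) e′<w ⟩
    w + G * S  ≡⟨ +-comm w (G * S) ⟩
    G * S + w  ∎
    where open ≤-Reasoning
  GS<D+w : G * S < D + w
  GS<D+w = begin-strict
    G * S      ≤⟨ m≤n+m (G * S) e′ ⟩
    e′ + G * S ≡⟨ balance ⟨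
    e + D      <⟨ +-monoˡ-< D e<w ⟩
    w + D      ≡⟨ +-comm w D ⟩
    D + w      ∎
    where open ≤-Reasoning

window-gap : ∀ {S o w Y Y′ X X′} → InWindow S o w Y X → InWindow S o w Y′ X′ →
             X ≤ X′ → Y ≤ Y′ → Near w (Y′ ∸ Y) ((X′ ∸ X) * S)
window-gap {S} {o} {w} {Y} {Y′} {X} {X′} wY wY′ X≤X′ Y≤Y′ =
  window-difference {S} {o} {w} {Y} {X} {Y′ ∸ Y} {X′ ∸ X} wY
    (subst₂ (InWindow S o w) (sym (m+[n∸m]≡n Y≤Y′)) (sym (m+[n∸m]≡n X≤X′)) wY′)

near-mono : ∀ {S w D D′ G G′} → 2 * w ≤ S →
            Near w D (G * S) → Near w D′ (G′ * S) → G < G′ → D < D′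
near-mono {S} {w} {D} {D′} {G} {G′} 2w≤S (D<GS+w , _) (_ , G′S<D′+w) G<G′ =
  +-cancelʳ-< w D D′ (begin-strict
    D + w          <⟨ +-monoˡ-< w D<GS+w ⟩
    G * S + w + w  ≡⟨ +-assoc (G * S) w w ⟩
    G * S + (w + w) ≡⟨ cong (λ k → G * S + (w + k)) (+-identityʳ w) ⟨
    G * S + 2 * w  ≤⟨ +-monoʳ-≤ (G * S) 2w≤S ⟩
    G * S + S      ≡⟨ +-comm (G * S) S ⟩
    suc G * S      ≤⟨ *-monoˡ-≤ S G<G′ ⟩
    G′ * S         <⟨ G′S<D′+w ⟩
    D′ + w         ∎)
  where open ≤-Reasoning

pinch-inject₁-self : ∀ {m} (p : Fin (suc m)) → pinch p (inject₁ p) ≡ p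
pinch-inject₁-self fzero = refl
pinch-inject₁-self {suc m} (fsuc p) = cong fsuc (pinch-inject₁-self p)

pinch-suc-self : ∀ {m} (p : Fin (suc m)) → pinch p (fsuc p) ≡ p
pinch-suc-self fzero = refl
pinch-suc-self {suc m} (fsuc p) = cong fsuc (pinch-suc-self p)

pinch-inject₁-punchIn : ∀ {m} (p : Fin (suc m)) (i : Fin m) → pinch p (inject₁ (punchIn p i)) ≡ inject₁ i
pinch-inject₁-punchIn fzero    i        = refl
pinch-inject₁-punchIn (fsuc p) fzero    = refl
pinch-inject₁-punchIn (fsuc p) (fsuc i) = cong fsuc (pinch-inject₁-punchIn p i)

pinch-suc-punchIn : ∀ {m} (p : Fin (suc m)) (i : Fin m) → pinch p (fsuc (punchIn p i)) ≡ fsuc i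
pinch-suc-punchIn fzero    i        = refl
pinch-suc-punchIn (fsuc p) fzero    = refl
pinch-suc-punchIn (fsuc p) (fsuc i) = cong fsuc (pinch-suc-punchIn p i)

gap-∘pinch-self : ∀ {m n} (x : Fin (suc m) → Fin n) (p : Fin (suc m)) → gap (x ∘ pinch p) p ≡ 0
gap-∘pinch-self x p rewrite pinch-inject₁-self p | pinch-suc-self p = n∸n≡0 (toℕ (x p))

gap-∘pinch-punchIn : ∀ {m n} (x : Fin (suc m) → Fin n) (p : Fin (suc m)) (i : Fin m) →
                     gap (x ∘ pinch p) (punchIn p i) ≡ gap x i
gap-∘pinch-punchIn x p i rewrite pinch-inject₁-punchIn p i | pinch-suc-punchIn p i = refl

data Position {m} (p : Fin (suc m)) : Fin (suc m) → Set where
  at  : Position p p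
  off : (i : Fin m) → Position p (punchIn p i)

position : ∀ {m} (p τ : Fin (suc m)) → Position p τ
position p τ with p ≟ᶠ τ
... | yes refl = at
... | no  p≢τ  = subst (Position p) (punchIn-punchOut p≢τ) (off (punchOut p≢τ))

insertAfter : ∀ {m} {X : Set} → Fin (suc m) → (Fin (suc m) → X) → X → Fin (suc (suc m)) → X
insertAfter p u v t with t ≟ᶠ fsuc p
... | yes _ = v
... | no  _ = u (pinch p t)

module _ {m} {X : Set} {p : Fin (suc m)} {u : Fin (suc m) → X} {v : X} where

  insertAfter-elim : (P : Fin (suc (suc m)) → X → Set) → (∀ t → P t (u (pinch p t))) → P (fsuc p) v →
                     ∀ t → P t (insertAfter p u v t)
  insertAfter-elim P Pu Pv t with t ≟ᶠ fsuc p
  ... | yes refl = Pv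
  ... | no  _    = Pu t

  insertAfter-inserted : insertAfter p u v (fsuc p) ≡ v
  insertAfter-inserted with fsuc p ≟ᶠ fsuc p
  ... | yes _   = refl
  ... | no  p≢p = contradiction refl p≢p

  insertAfter-before : insertAfter p u v (inject₁ p) ≡ u p
  insertAfter-before with inject₁ p ≟ᶠ fsuc p
  ... | yes p≡1+p = contradiction (trans (sym (toℕ-inject₁ p)) (cong toℕ p≡1+p)) (1+n≢n ∘ sym)
  ... | no  _     = cong u (pinch-inject₁-self p)

permutation-order-⇔ : ∀ {k} (π : Permutation′ k) (f : Fin k → ℕ) →
  (∀ σ τ → toℕ (π ⟨$⟩ʳ τ) < toℕ (π ⟨$⟩ʳ σ) → f τ < f σ) →
  ∀ σ τ → (f τ < f σ) ⇔ (toℕ (π ⟨$⟩ʳ τ) < toℕ (π ⟨$⟩ʳ σ))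
permutation-order-⇔ π f mono σ τ = mk⇔ reflect (mono σ τ)
  where
  injective : ∀ {σ τ} → toℕ (π ⟨$⟩ʳ τ) ≡ toℕ (π ⟨$⟩ʳ σ) → τ ≡ σ
  injective eq = trans (sym (inverseˡ π)) (trans (cong (π ⟨$⟩ˡ_) (toℕ-injective eq)) (inverseˡ π))
  reflect : f τ < f σ → toℕ (π ⟨$⟩ʳ τ) < toℕ (π ⟨$⟩ʳ σ)
  reflect fτ<fσ with <-cmp (toℕ (π ⟨$⟩ʳ τ)) (toℕ (π ⟨$⟩ʳ σ))
  ... | tri< πτ<πσ _ _ = πτ<πσ
  ... | tri≈ _ πτ≡πσ _ = contradiction fτ<fσ (<-irrefl (cong f (injective πτ≡πσ)))
  ... | tri> _ _ πσ<πτ = contradiction (mono τ σ πσ<πτ) (<-asym fτ<fσ)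

module Lifting {m} (π : Permutation′ (suc m)) (π′ : Permutation′ m)
               (norm : IsNormalization π′ (removeOne π)) where

  lowest : Fin (suc m)
  lowest = π ⟨$⟩ˡ fzero

  pinch-lowest-ordered : ∀ {n} {x : Fin (suc m) → Fin n} → IsWave π′ x → ∀ σ τ →
    toℕ (π ⟨$⟩ʳ τ) < toℕ (π ⟨$⟩ʳ σ) → gap (x ∘ pinch lowest) τ < gap (x ∘ pinch lowest) σ
  pinch-lowest-ordered {x = x} (increasing , x-ordered) σ τ πτ<πσ
    with position lowest σ | position lowest τ
  ... | at    | _     = contradiction (subst (λ k → toℕ (π ⟨$⟩ʳ τ) < toℕ k) (inverseʳ π) πτ<πσ) n≮0
  ... | off j | at    rewrite gap-∘pinch-self x lowest | gap-∘pinch-punchIn x lowest j =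
    m<n⇒0<n∸m (increasing j)
  ... | off j | off i rewrite gap-∘pinch-punchIn x lowest i | gap-∘pinch-punchIn x lowest j =
    Equivalence.from (x-ordered j i) (Equivalence.from (norm j i) πτ<πσ)

  lift-wave : ∀ {n S o w} {x u : Fin (suc m) → Fin n} {v : Fin n} → 2 * w ≤ S → IsWave π′ x →
    (∀ i → InWindow S o w (toℕ (u i)) (toℕ (x i))) →
    toℕ (u lowest) < toℕ v → InWindow S o w (toℕ v) (toℕ (x lowest)) →
    IsWave π (insertAfter lowest u v)
  lift-wave {n} {S} {o} {w} {x} {u} {v} 2w≤S x-wave u-window u<v v-window =
    increasing , permutation-order-⇔ π (gap y) ordered
    where
    y z : Fin (suc (suc m)) → Fin n
    y = insertAfter lowest u v
    z = x ∘ pinch lowest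

    y-window : ∀ t → InWindow S o w (toℕ (y t)) (toℕ (z t))
    y-window = insertAfter-elim (λ t k → InWindow S o w (toℕ k) (toℕ (z t)))
      (λ t → u-window (pinch lowest t))
      (subst (λ k → InWindow S o w (toℕ v) (toℕ (x k))) (sym (pinch-suc-self lowest)) v-window)

    z-step : ∀ τ → toℕ (z (inject₁ τ)) ≤ toℕ (z (fsuc τ))
    z-step τ with position lowest τ
    ... | at    rewrite pinch-inject₁-self lowest | pinch-suc-self lowest = ≤-reflexive refl
    ... | off i rewrite pinch-inject₁-punchIn lowest i | pinch-suc-punchIn lowest i =
      <⇒≤ (proj₁ x-wave i)

    increasing : ∀ τ → toℕ (y (inject₁ τ)) < toℕ (y (fsuc τ))
    increasing τ with position lowest τ
    ... | at    rewrite insertAfter-before {p = lowest} {u} {v} | insertAfter-inserted {p = lowest} {u} {v} = u<v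
    ... | off i = window-< (≤-trans (m≤n*m w 2) 2w≤S) (y-window (inject₁ (punchIn lowest i)))
      (y-window (fsuc (punchIn lowest i))) z-rises
      where
      z-rises : toℕ (z (inject₁ (punchIn lowest i))) < toℕ (z (fsuc (punchIn lowest i)))
      z-rises rewrite pinch-inject₁-punchIn lowest i | pinch-suc-punchIn lowest i = proj₁ x-wave i

    near : ∀ τ → Near w (gap y τ) (gap z τ * S)
    near τ = window-gap (y-window (inject₁ τ)) (y-window (fsuc τ)) (z-step τ) (<⇒≤ (increasing τ))

    ordered : ∀ σ τ → toℕ (π ⟨$⟩ʳ τ) < toℕ (π ⟨$⟩ʳ σ) → gap y τ < gap y σ
    ordered σ τ πτ<πσ = near-mono 2w≤S (near τ) (near σ) (pinch-lowest-ordered {x = x} x-wave σ τ πτ<πσ)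

2^⌊log₂n⌋≤n : ∀ n → 1 ≤ n → 2 ^ ⌊log₂ n ⌋ ≤ n
2^⌊log₂n⌋≤n n = lower ⌊log₂ n ⌋ n refl
  where
  lower : ∀ j n → ⌊log₂ n ⌋ ≡ j → 1 ≤ n → 2 ^ j ≤ n
  lower zero    n _ 1≤n = 1≤n
  lower (suc j) 1 () _
  lower (suc j) n@(suc (suc k)) log≡ _ = begin
    2 * 2 ^ j             ≤⟨ *-monoʳ-≤ 2 (lower j ⌊ n /2⌋ half-log (s≤s z≤n)) ⟩
    ⌊ n /2⌋ + (⌊ n /2⌋ + 0) ≡⟨ cong (⌊ n /2⌋ +_) (+-identityʳ ⌊ n /2⌋) ⟩
    ⌊ n /2⌋ + ⌊ n /2⌋     ≤⟨ +-monoʳ-≤ ⌊ n /2⌋ (⌊n/2⌋≤⌈n/2⌉ n) ⟩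
    ⌊ n /2⌋ + ⌈ n /2⌉     ≡⟨ ⌊n/2⌋+⌈n/2⌉≡n n ⟩
    n                     ∎
    where
    open ≤-Reasoning
    half-log : ⌊log₂ ⌊ n /2⌋ ⌋ ≡ j
    half-log = trans (⌊log₂⌊n/2⌋⌋≡⌊log₂n⌋∸1 n) (cong (_∸ 1) log≡)

n<2^[1+⌊log₂n⌋] : ∀ n → n < 2 ^ suc ⌊log₂ n ⌋
n<2^[1+⌊log₂n⌋] n with n <? 2 ^ suc ⌊log₂ n ⌋
... | yes n<2^[1+L] = n<2^[1+L]
... | no  n≮2^[1+L] = contradiction
  (subst (_≤ ⌊log₂ n ⌋) (⌊log₂[2^n]⌋≡n (suc ⌊log₂ n ⌋)) (⌊log₂⌋-mono-≤ (≮⇒≥ n≮2^[1+L])))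
  1+n≰n

scale : ℕ → ℕ → ℕ
scale u v = ⌊log₂ (v ∸ u) ⌋

module Dyadic (u v : ℕ) where

  unit : ℕ
  unit = 2 ^ scale u v

  instance
    unit≢0 : NonZero unit
    unit≢0 = m^n≢0 2 (scale u v)

    8*unit≢0 : NonZero (8 * unit)
    8*unit≢0 = m*n≢0 8 unit

  block : ℕ
  block = u / (8 * unit)

  class : ℕ
  class = (u % (8 * unit)) / unit

  block≤u : block ≤ u
  block≤u = m/n≤m u (8 * unit)

  class<8 : class < 8
  class<8 = m<n*o⇒m/o<n (m%n<n u (8 * unit))

record Placed (s c B u v : ℕ) : Set where
  field
    offset width : ℕ
    offset<s     : offset < s
    s≤width      : s ≤ width
    width<2s     : width < 2 * s
    u≡           : u ≡ c * s + offset + B * (8 * s)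
    v≡           : v ≡ u + width

  u-window : InWindow (8 * s) (c * s) (3 * s) u B
  u-window = offset , ≤-trans offset<s (m≤n*m s 3) , u≡

  v-window : InWindow (8 * s) (c * s) (3 * s) v B
  v-window = offset + width , +-mono-< offset<s width<2s , (begin
    v                                  ≡⟨ v≡ ⟩
    u + width                          ≡⟨ cong (_+ width) u≡ ⟩
    c * s + offset + B * (8 * s) + width   ≡⟨ xy∙z≈xz∙y (c * s + offset) (B * (8 * s)) width ⟩
    c * s + offset + width + B * (8 * s)   ≡⟨ cong (_+ B * (8 * s)) (+-assoc (c * s) offset width) ⟩
    c * s + (offset + width) + B * (8 * s) ∎)
    where open ≡-Reasoning

placed : ∀ {u v} → u < v → let open Dyadic u v in Placed unit class block u v
placed {u} {v} u<v = record
  { offset   = r % unit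
  ; width    = v ∸ u
  ; offset<s = m%n<n r unit
  ; s≤width  = 2^⌊log₂n⌋≤n (v ∸ u) (m<n⇒0<n∸m u<v)
  ; width<2s = n<2^[1+⌊log₂n⌋] (v ∸ u)
  ; u≡       = begin
      u                                   ≡⟨ m≡m%n+[m/n]*n u (8 * unit) ⟩
      r + block * (8 * unit)              ≡⟨ cong (_+ block * (8 * unit)) (m≡m%n+[m/n]*n r unit) ⟩
      r % unit + class * unit + block * (8 * unit) ≡⟨ cong (_+ block * (8 * unit)) (+-comm (r % unit) _) ⟩
      class * unit + r % unit + block * (8 * unit) ∎
  ; v≡       = sym (m+[n∸m]≡n (<⇒≤ u<v))
  }
  where
  open ≡-Reasoning
  open Dyadic u v
  r = u % (8 * unit)

same-block⇒overlap : ∀ {s c B u v u′ v′} → Placed s c B u v → Placed s c B u′ v′ → u′ < v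
same-block⇒overlap {s} {c} {B} {u} {v} {u′} P P′ = begin-strict
  u′                               ≡⟨ Placed.u≡ P′ ⟩
  c * s + Placed.offset P′ + B * (8 * s) <⟨ +-monoˡ-< (B * (8 * s)) (+-monoʳ-< (c * s) (Placed.offset<s P′)) ⟩
  c * s + s + B * (8 * s)          ≤⟨ +-monoˡ-≤ (B * (8 * s)) (+-monoˡ-≤ s (m≤m+n (c * s) e)) ⟩
  c * s + e + s + B * (8 * s)      ≡⟨ xy∙z≈xz∙y (c * s + e) s (B * (8 * s)) ⟩
  c * s + e + B * (8 * s) + s      ≡⟨ cong (_+ s) (Placed.u≡ P) ⟨
  u + s                            ≤⟨ +-monoʳ-≤ u (Placed.s≤width P) ⟩
  u + Placed.width P               ≡⟨ Placed.v≡ P ⟨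
  v                                ∎
  where
  open ≤-Reasoning
  e = Placed.offset P

elements : ∀ {n} → Subset n → List (Fin n)
elements []            = []
elements (inside  ∷ A) = fzero ∷ map fsuc (elements A)
elements (outside ∷ A) = map fsuc (elements A)

length-elements : ∀ {n} (A : Subset n) → length (elements A) ≡ ∣ A ∣
length-elements []            = refl
length-elements (inside  ∷ A) = cong suc (trans (length-map fsuc (elements A)) (length-elements A))
length-elements (outside ∷ A) = trans (length-map fsuc (elements A)) (length-elements A)

elements-∈ : ∀ {n} (A : Subset n) → All (_∈ A) (elements A)
elements-∈ []            = []
elements-∈ (inside  ∷ A) = here ∷ map⁺ (All.map there (elements-∈ A))
elements-∈ (outside ∷ A) = map⁺ (All.map there (elements-∈ A))

elements-sorted : ∀ {n} (A : Subset n) → AllPairs _<ᶠ_ (elements A)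
elements-sorted []            = []
elements-sorted (inside  ∷ A) =
  map⁺ (All.universal (λ _ → s≤s z≤n) _) ∷ AllPairs.map⁺ (AllPairs.map s≤s (elements-sorted A))
elements-sorted (outside ∷ A) = AllPairs.map⁺ (AllPairs.map s≤s (elements-sorted A))

adjacent : ∀ {X : Set} → List X → List (X × X)
adjacent []           = []
adjacent (x ∷ [])     = []
adjacent (x ∷ y ∷ xs) = (x , y) ∷ adjacent (y ∷ xs)

length-adjacent : ∀ {X : Set} (xs : List X) → length xs ≤ suc (length (adjacent xs))
length-adjacent []           = z≤n
length-adjacent (x ∷ [])     = s≤s z≤n
length-adjacent (x ∷ y ∷ xs) = s≤s (length-adjacent (y ∷ xs))

module _ {X : Set} where

  adjacent-All : ∀ {R : X → X → Set} {P : X → Set} {xs} → AllPairs R xs → All P xs →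
                 All (λ (x , y) → P x × P y × R x y) (adjacent xs)
  adjacent-All {xs = []}         _                   _                = []
  adjacent-All {xs = x ∷ []}     _                   _                = []
  adjacent-All {xs = x ∷ y ∷ xs} ((Rxy ∷ _) ∷ sorted) (Px ∷ Py ∷ Pxs) =
    (Px , Py , Rxy) ∷ adjacent-All sorted (Py ∷ Pxs)

  adjacent-proj₁ : ∀ {P : X → Set} {xs} → All P xs → All (P ∘ proj₁) (adjacent xs)
  adjacent-proj₁ {xs = []}         _               = []
  adjacent-proj₁ {xs = x ∷ []}     _               = []
  adjacent-proj₁ {xs = x ∷ y ∷ xs} (Px ∷ Py ∷ Pxs) = Px ∷ adjacent-proj₁ (Py ∷ Pxs)

adjacent-sorted : ∀ {n} {xs : List (Fin n)} → AllPairs _<ᶠ_ xs →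
                  AllPairs (λ P Q → proj₂ P ≤ᶠ proj₁ Q) (adjacent xs)
adjacent-sorted {xs = []}         _                   = []
adjacent-sorted {xs = x ∷ []}     _                   = []
adjacent-sorted {xs = x ∷ y ∷ xs} (_ ∷ y<xs ∷ sorted) =
  adjacent-proj₁ (≤-refl ∷ All.map <⇒≤ y<xs) ∷ adjacent-sorted (y<xs ∷ sorted)

unique⇒length≤∣p∣ : ∀ {n} {p : Subset n} {xs} → Unique xs → All (_∈ p) xs → length xs ≤ ∣ p ∣
unique⇒length≤∣p∣ {xs = []}     []            []          = z≤n
unique⇒length≤∣p∣ {xs = x ∷ xs} (x∉xs ∷ uniq) (x∈p ∷ xs∈p) =
  ≤-trans (s≤s (unique⇒length≤∣p∣ uniq xs∈p-x)) (x∈p⇒∣p-x∣<∣p∣ x∈p)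
  where
  xs∈p-x = All.zipWith (λ (y∈p , x≢y) → x∈p∧x≢y⇒x∈p-y y∈p (x≢y ∘ sym)) (xs∈p , x∉xs)

fromList : ∀ {n} → List (Fin n) → Subset n
fromList []       = ∅
fromList (x ∷ xs) = ⁅ x ⁆ ∪ fromList xs

∈-fromList⁺ : ∀ {n} {x : Fin n} {xs} → x ∈ₗ xs → x ∈ fromList xs
∈-fromList⁺ (here refl) = x∈p∪q⁺ (inj₁ (x∈⁅x⁆ _))
∈-fromList⁺ (there x∈xs) = x∈p∪q⁺ (inj₂ (∈-fromList⁺ x∈xs))

∈-fromList⁻ : ∀ {n} {x : Fin n} xs → x ∈ fromList xs → x ∈ₗ xs
∈-fromList⁻ []       x∈∅ = contradiction x∈∅ ∉⊥
∈-fromList⁻ (y ∷ xs) x∈p with x∈p∪q⁻ ⁅ y ⁆ (fromList xs) x∈p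
... | inj₁ x∈⁅y⁆ = here (x∈⁅y⁆⇒x≡y y x∈⁅y⁆)
... | inj₂ x∈ys  = there (∈-fromList⁻ xs x∈ys)

module _ {X : Set} (κ : X → ℕ) where

  length-filter-<-suc : ∀ K xs →
    length (filter (λ x → κ x <? suc K) xs) ≤ length (filter (λ x → κ x <? K) xs) + length (filter (λ x → κ x ≟ K) xs)
  length-filter-<-suc K [] = z≤n
  length-filter-<-suc K (x ∷ xs) with <-cmp (κ x) K
  ... | tri< κx<K κx≢K _
    rewrite filter-accept (λ y → κ y <? suc K) {x} {xs} (m<n⇒m<1+n κx<K)
          | filter-accept (λ y → κ y <? K) {x} {xs} κx<K
          | filter-reject (λ y → κ y ≟ K) {x} {xs} κx≢K
          = s≤s (length-filter-<-suc K xs)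
  ... | tri≈ κx≮K κx≡K _
    rewrite filter-accept (λ y → κ y <? suc K) {x} {xs} (s≤s (≤-reflexive κx≡K))
          | filter-reject (λ y → κ y <? K) {x} {xs} κx≮K
          | filter-accept (λ y → κ y ≟ K) {x} {xs} κx≡K
          = ≤-trans (s≤s (length-filter-<-suc K xs)) (≤-reflexive (sym (+-suc _ _)))
  ... | tri> κx≮K κx≢K K<κx
    rewrite filter-reject (λ y → κ y <? suc K) {x} {xs} (<⇒≱ K<κx ∘ ≤-pred)
          | filter-reject (λ y → κ y <? K) {x} {xs} κx≮K
          | filter-reject (λ y → κ y ≟ K) {x} {xs} κx≢K
          = length-filter-<-suc K xs

  length≤colours*bound : ∀ {K b} xs → All (λ x → κ x < K) xs →
    (∀ c → length (filter (λ x → κ x ≟ c) xs) ≤ b) → length xs ≤ K * b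
  length≤colours*bound {K} {b} xs κ<K classes =
    subst (_≤ K * b) (cong length (filter-all (λ x → κ x <? K) κ<K)) (below K)
    where
    below : ∀ K → length (filter (λ x → κ x <? K) xs) ≤ K * b
    below zero    = ≤-reflexive (cong length (filter-none (λ x → κ x <? 0) (All.universal (λ _ ()) xs)))
    below (suc K) = ≤-trans (length-filter-<-suc K xs)
                            (≤-trans (+-mono-≤ (below K) (classes K)) (≤-reflexive (+-comm (K * b) b)))

module _ {n : ℕ} where

  scaleᵖ classᵖ : Fin n × Fin n → ℕ
  scaleᵖ (u , v) = scale (toℕ u) (toℕ v)
  classᵖ (u , v) = Dyadic.class (toℕ u) (toℕ v)

  blockᵖ : Fin n × Fin n → Fin n
  blockᵖ (u , v) = fromℕ< (≤-<-trans (Dyadic.block≤u (toℕ u) (toℕ v)) (toℕ<n u))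

  Before : Fin n × Fin n → Fin n × Fin n → Set
  Before (_ , v) (u′ , _) = v ≤ᶠ u′

module Bounds {m} (π : Permutation′ (suc m)) (π′ : Permutation′ m)
              (norm : IsNormalization π′ (removeOne π)) {n} {A : Subset n} (A-free : WaveFree π A) where

  open Lifting π π′ norm

  Good : Fin n × Fin n → Set
  Good (u , v) = u ∈ A × v ∈ A × u <ᶠ v

  InClass : ℕ → ℕ → Fin n × Fin n → Set
  InClass j c P = Good P × scaleᵖ P ≡ j × classᵖ P ≡ c

  placedᵖ : ∀ {j c} P → InClass j c P → Placed (2 ^ j) c (toℕ (blockᵖ P)) (toℕ (proj₁ P)) (toℕ (proj₂ P))
  placedᵖ (u , v) ((_ , _ , u<v) , refl , refl) =
    subst (λ B → Placed (2 ^ scaleᵖ (u , v)) (classᵖ (u , v)) B (toℕ u) (toℕ v)) (sym (toℕ-fromℕ< _)) (placed u<v)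

  blocks-differ : ∀ {j c P P′} → InClass j c P → InClass j c P′ → Before P P′ → blockᵖ P ≢ blockᵖ P′
  blocks-differ {j} {c} {P} {P′} inP inP′ v≤u′ same = <⇒≱ (same-block⇒overlap (placedᵖ P inP)
    (subst (λ B → Placed (2 ^ j) c B (toℕ (proj₁ P′)) (toℕ (proj₂ P′))) (cong toℕ (sym same)) (placedᵖ P′ inP′)))
    v≤u′

  blocks-unique : ∀ {j c ps} → All (InClass j c) ps → AllPairs Before ps → Unique (map blockᵖ ps)
  blocks-unique in-class sorted = AllPairs.map⁺ (differ in-class sorted)
    where
    differ : ∀ {j c qs} → All (InClass j c) qs → AllPairs Before qs →
             AllPairs (λ P P′ → blockᵖ P ≢ blockᵖ P′) qs
    differ []            []                  = []
    differ (inP ∷ ins) (P-before ∷ sorted) =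
      All.zipWith (λ (inP′ , before) → blocks-differ inP inP′ before) (ins , P-before) ∷ differ ins sorted

  blocks-waveFree : ∀ {j c} ps → All (InClass j c) ps → WaveFree π′ (fromList (map blockᵖ ps))
  blocks-waveFree {j} {c} ps in-class (x , x-wave , x∈blocks) =
    A-free (insertAfter lowest u (v lowest) , lift-wave {x = x} 2w≤S x-wave (λ i → Placed.u-window (placedAt i))
                                                (u<v lowest) (Placed.v-window (placedAt lowest))
           , members)
    where
    s = 2 ^ j
    source : ∀ i → ∃[ P ] P ∈ₗ ps × x i ≡ blockᵖ P
    source i = ∈-map⁻ blockᵖ (∈-fromList⁻ (map blockᵖ ps) (x∈blocks i))
    u v : Fin (suc m) → Fin n
    u i = proj₁ (proj₁ (source i))
    v i = proj₂ (proj₁ (source i))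
    in-class-at : ∀ i → InClass j c (u i , v i)
    in-class-at i = All.lookup in-class (proj₁ (proj₂ (source i)))
    u<v : ∀ i → toℕ (u i) < toℕ (v i)
    u<v i = proj₂ (proj₂ (proj₁ (in-class-at i)))
    placedAt : ∀ i → Placed s c (toℕ (x i)) (toℕ (u i)) (toℕ (v i))
    placedAt i = subst (λ B → Placed s c B (toℕ (u i)) (toℕ (v i))) (cong toℕ (sym (proj₂ (proj₂ (source i)))))
                       (placedᵖ (u i , v i) (in-class-at i))
    2w≤S : 2 * (3 * s) ≤ 8 * s
    2w≤S = ≤-trans (≤-reflexive (sym (*-assoc 2 3 s))) (*-monoˡ-≤ s (m≤m+n 6 2))
    members : ∀ t → insertAfter lowest u (v lowest) t ∈ A
    members = insertAfter-elim (λ _ k → k ∈ A) (λ t → proj₁ (proj₁ (in-class-at (pinch lowest t))))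
                               (proj₁ (proj₂ (proj₁ (in-class-at lowest))))

  class-bound : ∀ {j c} ps → All (InClass j c) ps → AllPairs Before ps →
                ∃[ Q ] WaveFree π′ Q × length ps ≤ ∣ Q ∣
  class-bound ps in-class sorted =
    fromList (map blockᵖ ps) , blocks-waveFree ps in-class ,
    subst (_≤ ∣ fromList (map blockᵖ ps) ∣) (length-map blockᵖ ps)
          (unique⇒length≤∣p∣ (blocks-unique in-class sorted) (All.tabulate ∈-fromList⁺))

  size-bound : ∀ {b} → ((Q : Subset n) → WaveFree π′ Q → ∣ Q ∣ ≤ b) →
               ∣ A ∣ ≤ suc (suc ⌊log₂ n ⌋ * (8 * b))
  size-bound {b} b-max = begin
    ∣ A ∣                          ≡⟨ length-elements A ⟨
    length (elements A)            ≤⟨ length-adjacent (elements A) ⟩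
    suc (length ps)                ≤⟨ s≤s (length≤colours*bound scaleᵖ ps (All.map scale-bound good) per-scale) ⟩
    suc (suc ⌊log₂ n ⌋ * (8 * b))  ∎
    where
    open ≤-Reasoning
    ps = adjacent (elements A)
    good : All Good ps
    good = adjacent-All (elements-sorted A) (elements-∈ A)
    sorted : AllPairs Before ps
    sorted = adjacent-sorted (elements-sorted A)

    scale-bound : ∀ {P} → Good P → scaleᵖ P < suc ⌊log₂ n ⌋
    scale-bound {u , v} _ = s≤s (⌊log₂⌋-mono-≤ (<⇒≤ (≤-<-trans (m∸n≤m (toℕ v) (toℕ u)) (toℕ<n v))))

    by-scale : ∀ j → Decidable (λ P → scaleᵖ P ≡ j)
    by-scale j P = scaleᵖ P ≟ j

    by-class : ∀ c → Decidable (λ P → classᵖ P ≡ c)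
    by-class c P = classᵖ P ≟ c

    per-class : ∀ j c → length (filter (by-class c) (filter (by-scale j) ps)) ≤ b
    per-class j c with class-bound (filter (by-class c) (filter (by-scale j) ps)) in-class
                                   (AllPairs.filter⁺ (by-class c) (AllPairs.filter⁺ (by-scale j) sorted))
      where
      in-class : All (InClass j c) (filter (by-class c) (filter (by-scale j) ps))
      in-class = All.zip (All-filter⁺ (by-class c) (All-filter⁺ (by-scale j) good) ,
                          All.zip (All-filter⁺ (by-class c) (all-filter (by-scale j) ps) ,
                                   all-filter (by-class c) (filter (by-scale j) ps)))
    ... | Q , Q-free , length≤∣Q∣ = ≤-trans length≤∣Q∣ (b-max Q Q-free)

    per-scale : ∀ j → length (filter (by-scale j) ps) ≤ 8 * b
    per-scale j = length≤colours*bound classᵖ (filter (by-scale j) ps)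
      (All.universal (λ (u , v) → Dyadic.class<8 (toℕ u) (toℕ v)) _) (per-class j)

singleton-waveFree : ∀ {m n} → 1 ≤ m → (σ : Permutation′ m) (i : Fin n) → WaveFree σ ⁅ i ⁆
singleton-waveFree {suc m} _ σ i (x , (increasing , _) , x∈⁅i⁆) =
  <ᶠ-irrefl (trans (x∈⁅y⁆⇒x≡y i (x∈⁅i⁆ _)) (sym (x∈⁅y⁆⇒x≡y i (x∈⁅i⁆ _)))) (increasing fzero)

waveFree-max-positive : ∀ {m n b} → 1 ≤ m → 1 ≤ n → (σ : Permutation′ m) →
                        ((Q : Subset n) → WaveFree σ Q → ∣ Q ∣ ≤ b) → 1 ≤ b
waveFree-max-positive {n = suc n} {b} 1≤m _ σ b-max =
  subst (_≤ b) (∣⁅x⁆∣≡1 {n = suc n} fzero) (b-max ⁅ fzero ⁆ (singleton-waveFree 1≤m σ fzero))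

power-bound : ∀ {n a b L} → 2 ≤ n → 1 ≤ b → 2 ^ L ≤ n → a ≤ suc (suc L * (8 * b)) → 2 ^ a ≤ n ^ (30 * b)
power-bound {n@(suc _)} {a} {b} {L} 2≤n 1≤b 2^L≤n a≤ = begin
  2 ^ a                      ≤⟨ ^-monoʳ-≤ 2 a≤ ⟩
  2 * 2 ^ (suc L * (8 * b))  ≡⟨ cong (2 *_) (^-*-assoc 2 (suc L) (8 * b)) ⟨
  2 * (2 ^ suc L) ^ (8 * b)  ≤⟨ *-mono-≤ 2≤n (^-monoˡ-≤ (8 * b) 2^[1+L]≤n^2) ⟩
  n * (n ^ 2) ^ (8 * b)      ≡⟨ cong (n *_) (^-*-assoc n 2 (8 * b)) ⟩
  n ^ suc (2 * (8 * b))      ≤⟨ ^-monoʳ-≤ n exponent-bound ⟩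
  n ^ (30 * b)               ∎
  where
  open ≤-Reasoning
  2^[1+L]≤n^2 : 2 ^ suc L ≤ n ^ 2
  2^[1+L]≤n^2 = begin
    2 * 2 ^ L ≤⟨ *-mono-≤ 2≤n 2^L≤n ⟩
    n * n     ≡⟨ cong (n *_) (*-identityʳ n) ⟨
    n ^ 2     ∎
  exponent-bound : suc (2 * (8 * b)) ≤ 30 * b
  exponent-bound = begin
    suc (2 * (8 * b))    ≤⟨ +-monoˡ-≤ (2 * (8 * b)) (≤-trans 1≤b (m≤n*m b 14)) ⟩
    14 * b + 2 * (8 * b) ≡⟨ cong (14 * b +_) (*-assoc 2 8 b) ⟨
    14 * b + 16 * b      ≡⟨ *-distribʳ-+ b 14 16 ⟨
    30 * b               ∎

theorem1p7 : (m : ℕ) → 1 ≤ m → (π : Permutation′ (suc m)) → (π′ : Permutation′ m) →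
    IsNormalization π′ (removeOne π) →
    (n : ℕ) → 1 < n → (a b : ℕ) → IsG π n a → IsG π′ n b →
    2 ^ a ≤ n ^ (30 * b)
theorem1p7 m 1≤m π π′ norm n 1<n a b ((A , A-free , refl) , _) (_ , b-max) =
  power-bound {L = ⌊log₂ n ⌋} 1<n (waveFree-max-positive 1≤m 1≤n π′ b-max) (2^⌊log₂n⌋≤n n 1≤n)
              (Bounds.size-bound π π′ norm A-free b-max)
  where
  1≤n : 1 ≤ n
  1≤n = <⇒≤ 1<n
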